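{- A finite simple graph $G$ satisfies $\mathrm{core}(G)=\mathrm{nucleus}(G)$ if and only if \[ \mathrm{core}(L_G^c)=\emptyset\quad\text{and}\quad \mathrm{corona}(G)\cap\partial_L(G)=\emptyset. \]
   Context: For $X\subseteq V(G)$, $N(X)$ is the union of neighborhoods of the vertices of $X$. For a graph $H$, $\Omega(H)$ is the family of maximum independent sets; $\mathrm{core}(H)=\bigcap\Omega(H)$ (empty when $H$ has no vertices), $\mathrm{corona}(H)=\bigcup\Omega(H)$. An independent set $I$ of $G$ is critical if $|I|-|N(I)|\ge|J|-|N(J)|$ for every independent set $J$; a maximum critical independent set is a critical independent set of maximum cardinality among critical independent sets; $\mathrm{nucleus}(G)$ is the intersection of all maximum critical independent sets. $L(G)$ denotes the set $J\cup N(J)$ for any maximum critical independent set $J$ of $G$ (this set does not depend on the choice of $J$); $L^c(G)=V(G)-L(G)$, $L_G^c=G[L^c(G)]$, and $\partial_L(G)=\{v\in L(G):N(v)\cap L^c(G)\neq\emptyset\}$. -}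

module Defs where

open import Data.Nat using (ℕ; _≤_)
open import Data.Bool using (Bool; true; false; _∧_; _∨_)
open import Data.Fin using (Fin; zero; suc)
open import Data.Fin.Subset using (Subset; _∈_; _∉_; _⊆_; ∣_∣; ∁; _∪_; ⊤)
open import Data.Vec using (tabulate)
open import Data.Integer using (ℤ; _⊖_; _≤_)
open import Data.Product using (_×_; ∃; Σ)
open import Relation.Nullary using (¬_)
open import Relation.Binary.PropositionalEquality using (_≡_)

record Graph (n : ℕ) : Set where
  field
    adj    : Fin n → Fin n → Bool
    sym    : ∀ u v → adj u v ≡ adj v u
    irrefl : ∀ v → adj v v ≡ false
open Graph public

anyFin : ∀ {n} → (Fin n → Bool) → Bool
anyFin {ℕ.zero}  f = false
anyFin {ℕ.suc n} f = f zero ∨ anyFin (λ i → f (suc i))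

module _ {n : ℕ} (G : Graph n) where

  N : Subset n → Subset n
  N X = tabulate (λ v → anyFin (λ u → Data.Vec.lookup X u ∧ adj G u v))

  Independent : Subset n → Set
  Independent S = ∀ u v → u ∈ S → v ∈ S → adj G u v ≡ false

  surplus : Subset n → ℤ
  surplus I = ∣ I ∣ ⊖ ∣ N I ∣

  Critical : Subset n → Set
  Critical I = Independent I × (∀ J → Independent J → surplus J Data.Integer.≤ surplus I)

  MaxCritical : Subset n → Set
  MaxCritical I = Critical I × (∀ J → Critical J → ∣ J ∣ Data.Nat.≤ ∣ I ∣)

  InNucleus : Fin n → Set
  InNucleus v = ∀ J → MaxCritical J → v ∈ J

  -- Maximum independent sets of the induced subgraph G[X]
  -- (independence in G[X] is independence in G for subsets of X).
  MaxIndepIn : Subset n → Subset n → Set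
  MaxIndepIn X S = S ⊆ X × Independent S
                 × (∀ T → T ⊆ X → Independent T → ∣ T ∣ Data.Nat.≤ ∣ S ∣)

  InCoreIn : Subset n → Fin n → Set
  InCoreIn X v = v ∈ X × (∀ S → MaxIndepIn X S → v ∈ S)

  MaxIndep : Subset n → Set
  MaxIndep = MaxIndepIn ⊤

  InCore : Fin n → Set
  InCore = InCoreIn ⊤

  InCorona : Fin n → Set
  InCorona v = ∃ λ S → MaxIndep S × v ∈ S

  -- L(G) = J ∪ N(J) for a maximum critical independent set J
  L : Subset n → Subset n
  L J = J ∪ N J

  Lᶜ : Subset n → Subset n
  Lᶜ J = ∁ (L J)

  InBoundary : Subset n → Fin n → Set
  InBoundary J v = v ∈ L J × ∃ λ w → w ∈ Lᶜ J × adj G v w ≡ true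

{-# OPTIONS --safe #-}
-- Fix a maximum critical independent set J and put L = J ∪ N J. Supermodularity of the surplus
-- ∣ X ∣ - ∣ N X ∣ shows that every critical set lies in L and that N J satisfies Hall's condition
-- into J. Hence ∣ S ∩ L ∣ ≤ ∣ J ∣ for every independent S, so the maximum independent sets of G[Lᶜ]
-- are exactly the traces S ∩ Lᶜ of those of G, each extending to J ∪ (S ∩ Lᶜ) ∈ Ω(G). Thus
-- core G ∩ Lᶜ = core G[Lᶜ], while core G ∩ L lies in every maximum critical set. For S ∈ Ω(G),
-- S ∩ L is maximum critical as soon as N (S ∩ L) ⊆ L, which corona G ∩ ∂L = ∅ guarantees; this
-- gives nucleus G ⊆ core G. Conversely, a vertex of S ∩ N J with a neighbour outside L is adjacent
-- to its partner under a matching of N J into J, and that partner lies in every maximum critical set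
-- but not in S.
module Submission where

open import Defs hiding (sym)
open import Data.Nat using (ℕ; zero; suc; _+_; _≤_; _<_; z≤n; s≤s)
open import Data.Nat.Properties
open import Data.Nat.Tactic.RingSolver using (solve-∀)
open import Data.Bool using (Bool; true; false; _∧_)
import Data.Bool as Bool
open import Data.Bool.Properties using (∧-conicalˡ; ∧-conicalʳ; ¬-not)
open import Data.Fin using (Fin; zero; suc)
open import Data.Fin.Properties using (all?) renaming (_≟_ to _≟ᶠ_)
open import Data.Fin.Subset
open import Data.Fin.Subset.Properties
open import Data.Vec using (_∷_; []; here; there; lookup)
open import Data.Vec.Properties using ([]=⇒lookup; lookup⇒[]=; lookup∘tabulate)
open import Data.Product using (_×_; _,_; proj₁; proj₂; ∃)
open import Data.Sum using (inj₁; inj₂; [_,_]′)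
open import Relation.Nullary using (¬_; Dec; yes; no; contradiction)
open import Relation.Nullary.Decidable using (_→-dec_; _×-dec_)
open import Relation.Unary using (Decidable)
open import Relation.Binary.PropositionalEquality
  using (_≡_; refl; sym; trans; cong; cong₂; subst; subst₂; module ≡-Reasoning)
open import Function.Base using (id; _∘_)
open import Function.Bundles using (Equivalence; _⇔_; mk⇔)
import Data.Integer as ℤ
import Data.Integer.Properties as ℤ
import Data.Integer.Tactic.RingSolver as ℤ

private variable
  n : ℕ
  p q r : Subset n
  x : Fin n

x∈p─q⇒x∉q : (p q : Subset n) → x ∈ p ─ q → x ∉ q
x∈p─q⇒x∉q (true ∷ p) (false ∷ q) here        ()
x∈p─q⇒x∉q (_ ∷ p)    (true ∷ q)  (there x∈) (there x∈q) = x∈p─q⇒x∉q p q x∈ x∈q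
x∈p─q⇒x∉q (_ ∷ p)    (false ∷ q) (there x∈) (there x∈q) = x∈p─q⇒x∉q p q x∈ x∈q

p─q≡p∩∁q : (p q : Subset n) → p ─ q ≡ p ∩ ∁ q
p─q≡p∩∁q []          []          = refl
p─q≡p∩∁q (true ∷ p)  (true ∷ q)  = cong (false ∷_) (p─q≡p∩∁q p q)
p─q≡p∩∁q (true ∷ p)  (false ∷ q) = cong (true ∷_) (p─q≡p∩∁q p q)
p─q≡p∩∁q (false ∷ p) (true ∷ q)  = cong (false ∷_) (p─q≡p∩∁q p q)
p─q≡p∩∁q (false ∷ p) (false ∷ q) = cong (false ∷_) (p─q≡p∩∁q p q)

Disjoint : Subset n → Subset n → Set
Disjoint p q = ∀ {x} → x ∈ p → x ∉ q

x∈p⇒⁅x⁆⊆p : x ∈ p → ⁅ x ⁆ ⊆ p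
x∈p⇒⁅x⁆⊆p {x = x} {p} x∈p y∈⁅x⁆ = subst (_∈ p) (sym (x∈⁅y⁆⇒x≡y x y∈⁅x⁆)) x∈p

x∉p⇒Disjoint⁅x⁆p : x ∉ p → Disjoint ⁅ x ⁆ p
x∉p⇒Disjoint⁅x⁆p {x = x} {p} x∉p y∈⁅x⁆ y∈p = x∉p (subst (_∈ p) (x∈⁅y⁆⇒x≡y x y∈⁅x⁆) y∈p)

∣p∣≡∣p∩q∣+∣p─q∣ : (p q : Subset n) → ∣ p ∣ ≡ ∣ p ∩ q ∣ + ∣ p ─ q ∣
∣p∣≡∣p∩q∣+∣p─q∣ []          []          = refl
∣p∣≡∣p∩q∣+∣p─q∣ (true ∷ p)  (true ∷ q)  = cong suc (∣p∣≡∣p∩q∣+∣p─q∣ p q)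
∣p∣≡∣p∩q∣+∣p─q∣ (true ∷ p)  (false ∷ q) =
  trans (cong suc (∣p∣≡∣p∩q∣+∣p─q∣ p q)) (sym (+-suc ∣ p ∩ q ∣ ∣ p ─ q ∣))
∣p∣≡∣p∩q∣+∣p─q∣ (false ∷ p) (true ∷ q)  = ∣p∣≡∣p∩q∣+∣p─q∣ p q
∣p∣≡∣p∩q∣+∣p─q∣ (false ∷ p) (false ∷ q) = ∣p∣≡∣p∩q∣+∣p─q∣ p q

∣p∣≡∣p∩q∣+∣p∩∁q∣ : (p q : Subset n) → ∣ p ∣ ≡ ∣ p ∩ q ∣ + ∣ p ∩ ∁ q ∣
∣p∣≡∣p∩q∣+∣p∩∁q∣ p q = subst (λ r → ∣ p ∣ ≡ ∣ p ∩ q ∣ + ∣ r ∣) (p─q≡p∩∁q p q) (∣p∣≡∣p∩q∣+∣p─q∣ p q)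

∣p∪q∣+∣p∩q∣≡∣p∣+∣q∣ : (p q : Subset n) → ∣ p ∪ q ∣ + ∣ p ∩ q ∣ ≡ ∣ p ∣ + ∣ q ∣
∣p∪q∣+∣p∩q∣≡∣p∣+∣q∣ []          []          = refl
∣p∪q∣+∣p∩q∣≡∣p∣+∣q∣ (true ∷ p)  (true ∷ q)  = cong suc (begin
  ∣ p ∪ q ∣ + suc ∣ p ∩ q ∣   ≡⟨ +-suc ∣ p ∪ q ∣ ∣ p ∩ q ∣ ⟩
  suc (∣ p ∪ q ∣ + ∣ p ∩ q ∣) ≡⟨ cong suc (∣p∪q∣+∣p∩q∣≡∣p∣+∣q∣ p q) ⟩
  suc (∣ p ∣ + ∣ q ∣)         ≡⟨ sym (+-suc ∣ p ∣ ∣ q ∣) ⟩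
  ∣ p ∣ + suc ∣ q ∣           ∎)
  where open ≡-Reasoning
∣p∪q∣+∣p∩q∣≡∣p∣+∣q∣ (true ∷ p)  (false ∷ q) = cong suc (∣p∪q∣+∣p∩q∣≡∣p∣+∣q∣ p q)
∣p∪q∣+∣p∩q∣≡∣p∣+∣q∣ (false ∷ p) (true ∷ q)  =
  trans (cong suc (∣p∪q∣+∣p∩q∣≡∣p∣+∣q∣ p q)) (sym (+-suc ∣ p ∣ ∣ q ∣))
∣p∪q∣+∣p∩q∣≡∣p∣+∣q∣ (false ∷ p) (false ∷ q) = ∣p∪q∣+∣p∩q∣≡∣p∣+∣q∣ p q

∣p∪q∣≤∣p∣+∣q∣ : (p q : Subset n) → ∣ p ∪ q ∣ ≤ ∣ p ∣ + ∣ q ∣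
∣p∪q∣≤∣p∣+∣q∣ p q = subst (∣ p ∪ q ∣ ≤_) (∣p∪q∣+∣p∩q∣≡∣p∣+∣q∣ p q) (m≤m+n _ _)

∪-lub : p ⊆ r → q ⊆ r → p ∪ q ⊆ r
∪-lub {p = p} {q = q} p⊆r q⊆r x∈p∪q with x∈p∪q⁻ p q x∈p∪q
... | inj₁ x∈p = p⊆r x∈p
... | inj₂ x∈q = q⊆r x∈q

p⊆q∪[p─q] : (p q : Subset n) → p ⊆ q ∪ (p ─ q)
p⊆q∪[p─q] p q {x} x∈p with x ∈? q
... | yes x∈q = p⊆p∪q (p ─ q) x∈q
... | no  x∉q = q⊆p∪q q (p ─ q) (x∈p∧x∉q⇒x∈p─q x∈p x∉q)

Empty⇒∣p∣≡0 : Empty p → ∣ p ∣ ≡ 0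
Empty⇒∣p∣≡0 {n} e = trans (cong ∣_∣ (Empty-unique e)) (∣⊥∣≡0 n)

Disjoint⇒∣p∪q∣≡∣p∣+∣q∣ : (p q : Subset n) → Disjoint p q → ∣ p ∪ q ∣ ≡ ∣ p ∣ + ∣ q ∣
Disjoint⇒∣p∪q∣≡∣p∣+∣q∣ p q p#q = begin
  ∣ p ∪ q ∣             ≡⟨ sym (+-identityʳ _) ⟩
  ∣ p ∪ q ∣ + 0         ≡⟨ cong (∣ p ∪ q ∣ +_) (sym (Empty⇒∣p∣≡0 p∩q-empty)) ⟩
  ∣ p ∪ q ∣ + ∣ p ∩ q ∣ ≡⟨ ∣p∪q∣+∣p∩q∣≡∣p∣+∣q∣ p q ⟩
  ∣ p ∣ + ∣ q ∣         ∎
  where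
  open ≡-Reasoning
  p∩q-empty : Empty (p ∩ q)
  p∩q-empty (_ , x∈p∩q) = let x∈p , x∈q = x∈p∩q⁻ p q x∈p∩q in p#q x∈p x∈q

Disjoint⇒∣p∣+∣q∣≤∣r∣ : Disjoint p q → p ⊆ r → q ⊆ r → ∣ p ∣ + ∣ q ∣ ≤ ∣ r ∣
Disjoint⇒∣p∣+∣q∣≤∣r∣ {p = p} {q} p#q p⊆r q⊆r =
  subst (_≤ _) (Disjoint⇒∣p∪q∣≡∣p∣+∣q∣ p q p#q) (p⊆q⇒∣p∣≤∣q∣ (∪-lub p⊆r q⊆r))

x∈p⇒∣p∣≡1+∣p-x∣ : x ∈ p → ∣ p ∣ ≡ suc ∣ p - x ∣
x∈p⇒∣p∣≡1+∣p-x∣ {x = x} {p} x∈p = begin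
  ∣ p ∣                     ≡⟨ ∣p∣≡∣p∩q∣+∣p─q∣ p ⁅ x ⁆ ⟩
  ∣ p ∩ ⁅ x ⁆ ∣ + ∣ p - x ∣ ≡⟨ cong (λ s → ∣ s ∣ + ∣ p - x ∣) p∩⁅x⁆≡⁅x⁆ ⟩
  ∣ ⁅ x ⁆ ∣ + ∣ p - x ∣     ≡⟨ cong (_+ ∣ p - x ∣) (∣⁅x⁆∣≡1 x) ⟩
  suc ∣ p - x ∣             ∎
  where
  open ≡-Reasoning
  p∩⁅x⁆≡⁅x⁆ : p ∩ ⁅ x ⁆ ≡ ⁅ x ⁆
  p∩⁅x⁆≡⁅x⁆ = ⊆-antisym (p∩q⊆q p ⁅ x ⁆) (λ y∈⁅x⁆ → x∈p∩q⁺ (x∈p⇒⁅x⁆⊆p x∈p y∈⁅x⁆ , y∈⁅x⁆))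

p⊆q∧∣q∣≤∣p∣⇒q⊆p : p ⊆ q → ∣ q ∣ ≤ ∣ p ∣ → q ⊆ p
p⊆q∧∣q∣≤∣p∣⇒q⊆p {p = p} {q} p⊆q ∣q∣≤∣p∣ {x} x∈q with x ∈? p
... | yes x∈p = x∈p
... | no  x∉p = contradiction ∣q∣≤∣p∣ (<⇒≱ (≤-<-trans (p⊆q⇒∣p∣≤∣q∣ p⊆q-x) (x∈p⇒∣p-x∣<∣p∣ x∈q)))
  where
  p⊆q-x : p ⊆ q - x
  p⊆q-x y∈p = x∈p∧x≢y⇒x∈p-y (p⊆q y∈p) λ { refl → x∉p y∈p }

injection⇒∣p∣≤∣q∣ : (f : Fin n → Fin n) → (∀ {x} → x ∈ p → f x ∈ q) →
                    (∀ {x y} → x ∈ p → y ∈ p → f x ≡ f y → x ≡ y) → ∣ p ∣ ≤ ∣ q ∣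
injection⇒∣p∣≤∣q∣ {p = p} f = go ∣ p ∣ ≤-refl
  where
  go : ∀ k {p q} → ∣ p ∣ ≤ k → (∀ {x} → x ∈ p → f x ∈ q) →
       (∀ {x y} → x ∈ p → y ∈ p → f x ≡ f y → x ≡ y) → ∣ p ∣ ≤ ∣ q ∣
  go zero    ∣p∣≤0 _ _ = ≤-trans ∣p∣≤0 z≤n
  go (suc k) {p} {q} ∣p∣≤1+k into inj with nonempty? p
  ... | no  p-empty  = ≤-trans (≤-reflexive (Empty⇒∣p∣≡0 p-empty)) z≤n
  ... | yes (x , x∈p) = begin
      ∣ p ∣               ≡⟨ x∈p⇒∣p∣≡1+∣p-x∣ x∈p ⟩
      suc ∣ p - x ∣       ≤⟨ s≤s (go k ∣p-x∣≤k into′ inj′) ⟩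
      suc ∣ q - f x ∣     ≡⟨ sym (x∈p⇒∣p∣≡1+∣p-x∣ (into x∈p)) ⟩
      ∣ q ∣               ∎
    where
    open ≤-Reasoning
    ∣p-x∣≤k : ∣ p - x ∣ ≤ k
    ∣p-x∣≤k = ≤-pred (subst (_≤ suc k) (x∈p⇒∣p∣≡1+∣p-x∣ x∈p) ∣p∣≤1+k)
    ∈p-x⇒∈p : ∀ {y} → y ∈ p - x → y ∈ p
    ∈p-x⇒∈p = p─q⊆p p ⁅ x ⁆
    into′ : ∀ {y} → y ∈ p - x → f y ∈ q - f x
    into′ {y} y∈p-x = x∈p∧x≢y⇒x∈p-y (into (∈p-x⇒∈p y∈p-x)) λ fy≡fx →
      x∈p─q⇒x∉q p ⁅ x ⁆ y∈p-x (subst (_∈ ⁅ x ⁆) (sym (inj (∈p-x⇒∈p y∈p-x) x∈p fy≡fx)) (x∈⁅x⁆ x))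
    inj′ : ∀ {y z} → y ∈ p - x → z ∈ p - x → f y ≡ f z → y ≡ z
    inj′ y∈ z∈ = inj (∈p-x⇒∈p y∈) (∈p-x⇒∈p z∈)

module _ {P : Subset n → Set} (P? : Decidable P) where

  ∃-largest : ∀ {S₀} → P S₀ → ∃ λ S → P S × (∀ T → P T → ∣ T ∣ ≤ ∣ S ∣)
  ∃-largest {S₀} P-S₀ = search n (λ T _ → ∣p∣≤n T)
    where
    search : ∀ k → (∀ T → P T → ∣ T ∣ ≤ k) → ∃ λ S → P S × (∀ T → P T → ∣ T ∣ ≤ ∣ S ∣)
    search k bound with anySubset? (λ T → P? T ×-dec (k ≤? ∣ T ∣))
    ... | yes (S , P-S , k≤∣S∣) = S , P-S , λ T P-T → ≤-trans (bound T P-T) k≤∣S∣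
    search zero    bound | no none = contradiction (S₀ , P-S₀ , z≤n) none
    search (suc k) bound | no none =
      search k λ T P-T → ≤-pred (≰⇒> λ 1+k≤∣T∣ → none (T , P-T , 1+k≤∣T∣))

m⊖n≤o⊖p⇔m+p≤o+n : ∀ m n o p → (m ℤ.⊖ n) ℤ.≤ (o ℤ.⊖ p) ⇔ m + p ≤ o + n
m⊖n≤o⊖p⇔m+p≤o+n m n o p = mk⇔
  (λ le → ≮⇒≥ λ lt → ℤ.<⇒≱ (subst₂ ℤ._<_ o-side m-side (ℤ.⊖-monoˡ-< (n + p) lt)) le)
  (λ le → subst₂ ℤ._≤_ m-side o-side (ℤ.⊖-monoˡ-≤ (n + p) le))
  where
  m-side : (m + p) ℤ.⊖ (n + p) ≡ m ℤ.⊖ n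
  m-side = trans (cong₂ ℤ._⊖_ (+-comm m p) (+-comm n p)) (ℤ.+-cancelˡ-⊖ p m n)
  o-side : (o + n) ℤ.⊖ (n + p) ≡ o ℤ.⊖ p
  o-side = trans (cong (ℤ._⊖ (n + p)) (+-comm o n)) (ℤ.+-cancelˡ-⊖ n o p)

[m⊖n]+[o⊖p]≡[m+o]⊖[n+p] : ∀ m n o p → (m ℤ.⊖ n) ℤ.+ (o ℤ.⊖ p) ≡ (m + o) ℤ.⊖ (n + p)
[m⊖n]+[o⊖p]≡[m+o]⊖[n+p] m n o p = begin
  (m ℤ.⊖ n) ℤ.+ (o ℤ.⊖ p)                     ≡⟨ sym (cong₂ ℤ._+_ (ℤ.[+m]-[+n]≡m⊖n m n) (ℤ.[+m]-[+n]≡m⊖n o p)) ⟩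
  (ℤ.+ m ℤ.- ℤ.+ n) ℤ.+ (ℤ.+ o ℤ.- ℤ.+ p)     ≡⟨ regroup (ℤ.+ m) (ℤ.+ n) (ℤ.+ o) (ℤ.+ p) ⟩
  (ℤ.+ m ℤ.+ ℤ.+ o) ℤ.- (ℤ.+ n ℤ.+ ℤ.+ p)     ≡⟨ cong₂ ℤ._-_ (sym (ℤ.pos-+ m o)) (sym (ℤ.pos-+ n p)) ⟩
  ℤ.+ (m + o) ℤ.- ℤ.+ (n + p)                 ≡⟨ ℤ.[+m]-[+n]≡m⊖n (m + o) (n + p) ⟩
  (m + o) ℤ.⊖ (n + p)                         ∎
  where
  open ≡-Reasoning
  regroup : ∀ a b c d → (a ℤ.- b) ℤ.+ (c ℤ.- d) ≡ (a ℤ.+ c) ℤ.- (b ℤ.+ d)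
  regroup = ℤ.solve-∀

ℤ-+-cancelʳ-≤ : ∀ {i j} k → i ℤ.+ k ℤ.≤ j ℤ.+ k → i ℤ.≤ j
ℤ-+-cancelʳ-≤ {i} {j} k le = subst₂ ℤ._≤_ (cancel i k) (cancel j k) (ℤ.+-monoˡ-≤ (ℤ.- k) le)
  where
  cancel : ∀ a b → a ℤ.+ b ℤ.- b ≡ a
  cancel = ℤ.solve-∀

anyFin⁺ : ∀ {n} (f : Fin n → Bool) i → f i ≡ true → anyFin f ≡ true
anyFin⁺ f zero    fi≡true rewrite fi≡true = refl
anyFin⁺ f (suc i) fi≡true with f zero
... | true  = refl
... | false = anyFin⁺ (λ j → f (suc j)) i fi≡true

anyFin⁻ : ∀ {n} (f : Fin n → Bool) → anyFin f ≡ true → ∃ λ i → f i ≡ true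
anyFin⁻ {suc n} f any≡true with f zero in f0≡
... | true  = zero , f0≡
... | false = let i , fi≡true = anyFin⁻ (λ j → f (suc j)) any≡true in suc i , fi≡true

module _ {n : ℕ} (G : Graph n) where

  private variable
    J K S T X Y : Subset n
    u v w y : Fin n

  adj-sym : adj G u v ≡ true → adj G v u ≡ true
  adj-sym {u} {v} e = trans (Graph.sym G v u) e

  x∈N⁺ : u ∈ X → adj G u y ≡ true → y ∈ N G X
  x∈N⁺ {u} {X} {y} u∈X u~y = lookup⇒[]= y (N G X) (trans (lookup∘tabulate _ y)
    (anyFin⁺ (λ w → lookup X w ∧ adj G w y) u (cong₂ _∧_ ([]=⇒lookup u∈X) u~y)))

  x∈N⁻ : y ∈ N G X → ∃ λ u → u ∈ X × adj G u y ≡ true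
  x∈N⁻ {y} {X} y∈NX =
    let u , e = anyFin⁻ (λ w → lookup X w ∧ adj G w y)
                        (trans (sym (lookup∘tabulate _ y)) ([]=⇒lookup y∈NX))
    in u , lookup⇒[]= u X (∧-conicalˡ _ _ e) , ∧-conicalʳ _ _ e

  N-mono : X ⊆ Y → N G X ⊆ N G Y
  N-mono X⊆Y x∈NX = let u , u∈X , u~x = x∈N⁻ x∈NX in x∈N⁺ (X⊆Y u∈X) u~x

  N-∪ : (X Y : Subset n) → N G (X ∪ Y) ⊆ N G X ∪ N G Y
  N-∪ X Y x∈N with x∈N⁻ x∈N
  ... | u , u∈X∪Y , u~x with x∈p∪q⁻ X Y u∈X∪Y
  ...   | inj₁ u∈X = p⊆p∪q (N G Y) (x∈N⁺ u∈X u~x)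
  ...   | inj₂ u∈Y = q⊆p∪q (N G X) (N G Y) (x∈N⁺ u∈Y u~x)

  N-∩ : (X Y : Subset n) → N G (X ∩ Y) ⊆ N G X ∩ N G Y
  N-∩ X Y x∈N = x∈p∩q⁺ (N-mono (p∩q⊆p X Y) x∈N , N-mono (p∩q⊆q X Y) x∈N)

  independent-⊆ : X ⊆ Y → Independent G Y → Independent G X
  independent-⊆ X⊆Y indY u v u∈X v∈X = indY u v (X⊆Y u∈X) (X⊆Y v∈X)

  independent⇒∉N : Independent G X → y ∈ X → y ∉ N G X
  independent⇒∉N indX y∈X y∈NX with x∈N⁻ y∈NX
  ... | u , u∈X , u~y with () ← trans (sym u~y) (indX u _ u∈X y∈X)

  independent? : Decidable (Independent G)
  independent? S = all? λ u → all? λ v → (u ∈? S) →-dec ((v ∈? S) →-dec (adj G u v Bool.≟ false))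

  independent-∪ : Independent G X → Independent G Y → Disjoint Y (N G X) → Independent G (X ∪ Y)
  independent-∪ {X} {Y} indX indY Y#NX u v u∈ v∈ with x∈p∪q⁻ X Y u∈ | x∈p∪q⁻ X Y v∈
  ... | inj₁ u∈X | inj₁ v∈X = indX u v u∈X v∈X
  ... | inj₂ u∈Y | inj₂ v∈Y = indY u v u∈Y v∈Y
  ... | inj₁ u∈X | inj₂ v∈Y = ¬-not λ u~v → Y#NX v∈Y (x∈N⁺ u∈X u~v)
  ... | inj₂ u∈Y | inj₁ v∈X = ¬-not λ u~v → Y#NX u∈Y (x∈N⁺ v∈X (adj-sym u~v))

  independent-─N : (X : Subset n) → Independent G (X ─ N G X)
  independent-─N X u v u∈ v∈ =
    ¬-not λ u~v → x∈p─q⇒x∉q X (N G X) v∈ (x∈N⁺ (p─q⊆p X (N G X) u∈) u~v)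

  ∃-maxIndepIn : (X : Subset n) → ∃ (MaxIndepIn G X)
  ∃-maxIndepIn X
    with ∃-largest (λ T → (T ⊆? X) ×-dec independent? T) {⊥} (⊥⊆ , λ _ _ u∈⊥ → contradiction u∈⊥ ∉⊥)
  ... | S , (S⊆X , indS) , S-largest = S , S⊆X , indS , λ T T⊆X indT → S-largest T (T⊆X , indT)

  -- Hall's theorem

  HallCondition : Subset n → Subset n → Set
  HallCondition X Y = ∀ B → B ⊆ X → ∣ B ∣ ≤ ∣ Y ∩ N G B ∣

  record Matching (X Y : Subset n) : Set where
    field
      partner   : Fin n → Fin n
      partner∈  : ∀ {u} → u ∈ X → partner u ∈ Y
      adjacent  : ∀ {u} → u ∈ X → adj G u (partner u) ≡ true
      injective : ∀ {u v} → u ∈ X → v ∈ X → partner u ≡ partner v → u ≡ v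

  Empty⇒Matching : Empty X → Matching X Y
  Empty⇒Matching X-empty = record
    { partner   = id
    ; partner∈  = λ u∈X → contradiction (_ , u∈X) X-empty
    ; adjacent  = λ u∈X → contradiction (_ , u∈X) X-empty
    ; injective = λ u∈X _ _ → contradiction (_ , u∈X) X-empty
    }

  ⁅⁆-Matching : adj G u v ≡ true → Matching ⁅ u ⁆ ⁅ v ⁆
  ⁅⁆-Matching {u} {v} u~v = record
    { partner   = λ _ → v
    ; partner∈  = λ _ → x∈⁅x⁆ v
    ; adjacent  = λ x∈⁅u⁆ → subst (λ x → adj G x v ≡ true) (sym (x∈⁅y⁆⇒x≡y u x∈⁅u⁆)) u~v
    ; injective = λ x∈⁅u⁆ y∈⁅u⁆ _ → trans (x∈⁅y⁆⇒x≡y u x∈⁅u⁆) (sym (x∈⁅y⁆⇒x≡y u y∈⁅u⁆))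
    }

  Matching-mono : X ⊆ Y → S ⊆ T → Matching Y S → Matching X T
  Matching-mono X⊆Y S⊆T M = record
    { partner   = partner
    ; partner∈  = λ u∈X → S⊆T (partner∈ (X⊆Y u∈X))
    ; adjacent  = λ u∈X → adjacent (X⊆Y u∈X)
    ; injective = λ u∈X v∈X → injective (X⊆Y u∈X) (X⊆Y v∈X)
    }
    where open Matching M

  Matching-∪ : Disjoint S T → Matching X S → Matching Y T → Matching (X ∪ Y) (S ∪ T)
  Matching-∪ {S} {T} {X} {Y} S#T M₁ M₂ = record
    { partner = partner ; partner∈ = partner∈ ; adjacent = adjacent ; injective = injective }
    where
    module M₁ = Matching M₁
    module M₂ = Matching M₂
    partner : Fin n → Fin n
    partner u with u ∈? X
    ... | yes _ = M₁.partner u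
    ... | no  _ = M₂.partner u
    ∈Y : ∀ {u} → u ∈ X ∪ Y → u ∉ X → u ∈ Y
    ∈Y {u} u∈X∪Y u∉X = [ (λ u∈X → contradiction u∈X u∉X) , id ]′ (x∈p∪q⁻ X Y u∈X∪Y)
    partner∈ : ∀ {u} → u ∈ X ∪ Y → partner u ∈ S ∪ T
    partner∈ {u} u∈X∪Y with u ∈? X
    ... | yes u∈X = p⊆p∪q T (M₁.partner∈ u∈X)
    ... | no  u∉X = q⊆p∪q S T (M₂.partner∈ (∈Y u∈X∪Y u∉X))
    adjacent : ∀ {u} → u ∈ X ∪ Y → adj G u (partner u) ≡ true
    adjacent {u} u∈X∪Y with u ∈? X
    ... | yes u∈X = M₁.adjacent u∈X
    ... | no  u∉X = M₂.adjacent (∈Y u∈X∪Y u∉X)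
    injective : ∀ {u v} → u ∈ X ∪ Y → v ∈ X ∪ Y → partner u ≡ partner v → u ≡ v
    injective {u} {v} u∈ v∈ eq with u ∈? X | v ∈? X
    ... | yes u∈X | yes v∈X = M₁.injective u∈X v∈X eq
    ... | no  u∉X | no  v∉X = M₂.injective (∈Y u∈ u∉X) (∈Y v∈ v∉X) eq
    ... | yes u∈X | no  v∉X =
      contradiction (M₂.partner∈ (∈Y v∈ v∉X)) (S#T (subst (_∈ S) eq (M₁.partner∈ u∈X)))
    ... | no  u∉X | yes v∈X =
      contradiction (M₂.partner∈ (∈Y u∈ u∉X)) (S#T (subst (_∈ S) (sym eq) (M₁.partner∈ v∈X)))

  Tight : Subset n → Subset n → Subset n → Set
  Tight X Y B = B ⊆ X × Nonempty B × ∣ B ∣ < ∣ X ∣ × ∣ Y ∩ N G B ∣ ≤ ∣ B ∣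

  tight? : (X Y : Subset n) → Decidable (Tight X Y)
  tight? X Y B = (B ⊆? X) ×-dec nonempty? B ×-dec (suc ∣ B ∣ ≤? ∣ X ∣) ×-dec (∣ Y ∩ N G B ∣ ≤? ∣ B ∣)

  SmallerMatchings : Subset n → Set
  SmallerMatchings X = ∀ {X′ Y′} → ∣ X′ ∣ < ∣ X ∣ → HallCondition X′ Y′ → Matching X′ Y′

  hall-tight : SmallerMatchings X → HallCondition X Y → ∀ {B} → Tight X Y B → Matching X Y
  hall-tight {X} {Y} IH hallXY {B} (B⊆X , (b , b∈B) , ∣B∣<∣X∣ , ∣Y∩NB∣≤∣B∣) =
    Matching-mono (p⊆q∪[p─q] X B) (∪-lub (p∩q⊆p Y (N G B)) (p─q⊆p Y (N G B)))
      (Matching-∪ Y∩NB#Y─NB (IH ∣B∣<∣X∣ hall₁) (IH ∣X─B∣<∣X∣ hall₂))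
    where
    open ≤-Reasoning
    Y∩NB#Y─NB : Disjoint (Y ∩ N G B) (Y ─ N G B)
    Y∩NB#Y─NB x∈Y∩NB x∈Y─NB = x∈p─q⇒x∉q Y (N G B) x∈Y─NB (p∩q⊆q Y (N G B) x∈Y∩NB)
    ∣X─B∣<∣X∣ : ∣ X ─ B ∣ < ∣ X ∣
    ∣X─B∣<∣X∣ = p∩q≢∅⇒∣p─q∣<∣p∣ X B (b , x∈p∩q⁺ (B⊆X b∈B , b∈B))
    hall₁ : HallCondition B (Y ∩ N G B)
    hall₁ C C⊆B = ≤-trans (hallXY C (B⊆X ∘ C⊆B)) (p⊆q⇒∣p∣≤∣q∣ λ x∈ →
      let x∈Y , x∈NC = x∈p∩q⁻ Y (N G C) x∈ in x∈p∩q⁺ (x∈p∩q⁺ (x∈Y , N-mono C⊆B x∈NC) , x∈NC))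
    hall₂ : HallCondition (X ─ B) (Y ─ N G B)
    hall₂ C C⊆X─B = +-cancelˡ-≤ (∣ B ∣) (∣ C ∣) (∣ (Y ─ N G B) ∩ N G C ∣) (begin
      ∣ B ∣ + ∣ C ∣                                  ≡⟨ sym (Disjoint⇒∣p∪q∣≡∣p∣+∣q∣ B C B#C) ⟩
      ∣ B ∪ C ∣                                      ≤⟨ hallXY (B ∪ C) (∪-lub B⊆X (p─q⊆p X B ∘ C⊆X─B)) ⟩
      ∣ Y ∩ N G (B ∪ C) ∣                            ≤⟨ p⊆q⇒∣p∣≤∣q∣ split ⟩
      ∣ (Y ∩ N G B) ∪ ((Y ─ N G B) ∩ N G C) ∣         ≤⟨ ∣p∪q∣≤∣p∣+∣q∣ (Y ∩ N G B) ((Y ─ N G B) ∩ N G C) ⟩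
      ∣ Y ∩ N G B ∣ + ∣ (Y ─ N G B) ∩ N G C ∣         ≤⟨ +-monoˡ-≤ (∣ (Y ─ N G B) ∩ N G C ∣) ∣Y∩NB∣≤∣B∣ ⟩
      ∣ B ∣ + ∣ (Y ─ N G B) ∩ N G C ∣                 ∎)
      where
      B#C : Disjoint B C
      B#C x∈B x∈C = x∈p─q⇒x∉q X B (C⊆X─B x∈C) x∈B
      split : Y ∩ N G (B ∪ C) ⊆ (Y ∩ N G B) ∪ ((Y ─ N G B) ∩ N G C)
      split {x} x∈ with x∈p∩q⁻ Y (N G (B ∪ C)) x∈ | x ∈? N G B
      ... | x∈Y , _      | yes x∈NB = p⊆p∪q ((Y ─ N G B) ∩ N G C) (x∈p∩q⁺ (x∈Y , x∈NB))
      ... | x∈Y , x∈NB∪C | no  x∉NB =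
        q⊆p∪q (Y ∩ N G B) ((Y ─ N G B) ∩ N G C) (x∈p∩q⁺ (x∈p∧x∉q⇒x∈p─q x∈Y x∉NB ,
          [ (λ x∈NB → contradiction x∈NB x∉NB) , id ]′ (x∈p∪q⁻ (N G B) (N G C) (N-∪ B C x∈NB∪C))))

  -- Without a tight set every nonempty proper C ⊆ X has more than ∣ C ∣ neighbours in Y, so Hall's
  -- condition survives deleting u from X and any neighbour y of u from Y.
  hall-loose : SmallerMatchings X → HallCondition X Y →
               (∀ B → B ⊆ X → Nonempty B → ∣ B ∣ < ∣ X ∣ → ∣ B ∣ < ∣ Y ∩ N G B ∣) → u ∈ X → Matching X Y
  hall-loose {X} {Y} {u} IH hallXY loose u∈X with nonempty? (Y ∩ N G ⁅ u ⁆)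
  ... | no  none = contradiction (hallXY ⁅ u ⁆ (x∈p⇒⁅x⁆⊆p u∈X))
                     (subst₂ (λ a b → ¬ a ≤ b) (sym (∣⁅x⁆∣≡1 u)) (sym (Empty⇒∣p∣≡0 none)) λ ())
  ... | yes (y , y∈) = Matching-mono (p⊆q∪[p─q] X ⁅ u ⁆) (∪-lub (x∈p⇒⁅x⁆⊆p y∈Y) (p─q⊆p Y ⁅ y ⁆))
          (Matching-∪ (x∉p⇒Disjoint⁅x⁆p (λ y∈Y-y → x∈p─q⇒x∉q Y ⁅ y ⁆ y∈Y-y (x∈⁅x⁆ y)))
            (⁅⁆-Matching u~y) (IH (x∈p⇒∣p-x∣<∣p∣ u∈X) hall′))
    where
    open ≤-Reasoning
    y∈Y : y ∈ Y
    y∈Y = p∩q⊆p Y (N G ⁅ u ⁆) y∈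
    u~y : adj G u y ≡ true
    u~y with x∈N⁻ (p∩q⊆q Y (N G ⁅ u ⁆) y∈)
    ... | u′ , u′∈⁅u⁆ , u′~y = subst (λ x → adj G x y ≡ true) (x∈⁅y⁆⇒x≡y u u′∈⁅u⁆) u′~y
    hall′ : HallCondition (X - u) (Y - y)
    hall′ C C⊆X-u with nonempty? C
    ... | no  C-empty = ≤-trans (≤-reflexive (Empty⇒∣p∣≡0 C-empty)) z≤n
    ... | yes C≠∅     = ≤-pred (begin-strict
      ∣ C ∣                            <⟨ loose C C⊆X C≠∅ ∣C∣<∣X∣ ⟩
      ∣ Y ∩ N G C ∣                    ≤⟨ p⊆q⇒∣p∣≤∣q∣ split ⟩
      ∣ ((Y - y) ∩ N G C) ∪ ⁅ y ⁆ ∣    ≤⟨ ∣p∪q∣≤∣p∣+∣q∣ ((Y - y) ∩ N G C) ⁅ y ⁆ ⟩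
      ∣ (Y - y) ∩ N G C ∣ + ∣ ⁅ y ⁆ ∣  ≡⟨ cong (∣ (Y - y) ∩ N G C ∣ +_) (∣⁅x⁆∣≡1 y) ⟩
      ∣ (Y - y) ∩ N G C ∣ + 1          ≡⟨ +-comm (∣ (Y - y) ∩ N G C ∣) 1 ⟩
      suc ∣ (Y - y) ∩ N G C ∣          ∎)
      where
      C⊆X : C ⊆ X
      C⊆X = p─q⊆p X ⁅ u ⁆ ∘ C⊆X-u
      ∣C∣<∣X∣ : ∣ C ∣ < ∣ X ∣
      ∣C∣<∣X∣ = ≤-<-trans (p⊆q⇒∣p∣≤∣q∣ C⊆X-u) (x∈p⇒∣p-x∣<∣p∣ u∈X)
      split : Y ∩ N G C ⊆ ((Y - y) ∩ N G C) ∪ ⁅ y ⁆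
      split {x} x∈ with x∈p∩q⁻ Y (N G C) x∈ | x ≟ᶠ y
      ... | _ , _       | yes refl = q⊆p∪q ((Y - y) ∩ N G C) ⁅ y ⁆ (x∈⁅x⁆ y)
      ... | x∈Y , x∈NC  | no  x≢y  = p⊆p∪q ⁅ y ⁆ (x∈p∩q⁺ (x∈p∧x≢y⇒x∈p-y x∈Y x≢y , x∈NC))

  hall : HallCondition X Y → Matching X Y
  hall {X} = go ∣ X ∣ ≤-refl
    where
    go : ∀ k {X Y} → ∣ X ∣ ≤ k → HallCondition X Y → Matching X Y
    go zero    ∣X∣≤0 _ = Empty⇒Matching λ (_ , x∈X) → n≮0 (≤-trans (x∈p⇒∣p-x∣<∣p∣ x∈X) ∣X∣≤0)
    go (suc k) {X} {Y} ∣X∣≤1+k hallXY = step (anySubset? (tight? X Y))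
      where
      IH : SmallerMatchings X
      IH ∣X′∣<∣X∣ = go k (≤-pred (≤-trans ∣X′∣<∣X∣ ∣X∣≤1+k))
      step : Dec (∃ (Tight X Y)) → Matching X Y
      step (yes (_ , tight)) = hall-tight IH hallXY tight
      step (no no-tight) with nonempty? X
      ... | no  X-empty   = Empty⇒Matching X-empty
      ... | yes (u , u∈X) = hall-loose IH hallXY
        (λ B B⊆X B≠∅ ∣B∣<∣X∣ → ≰⇒> λ tightB → no-tight (B , B⊆X , B≠∅ , ∣B∣<∣X∣ , tightB)) u∈X

  -- Surplus and critical sets

  ∣N∣-submodular : (A C : Subset n) → ∣ N G (A ∪ C) ∣ + ∣ N G (A ∩ C) ∣ ≤ ∣ N G A ∣ + ∣ N G C ∣
  ∣N∣-submodular A C = begin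
    ∣ N G (A ∪ C) ∣ + ∣ N G (A ∩ C) ∣       ≤⟨ +-mono-≤ (p⊆q⇒∣p∣≤∣q∣ (N-∪ A C)) (p⊆q⇒∣p∣≤∣q∣ (N-∩ A C)) ⟩
    ∣ N G A ∪ N G C ∣ + ∣ N G A ∩ N G C ∣   ≡⟨ ∣p∪q∣+∣p∩q∣≡∣p∣+∣q∣ (N G A) (N G C) ⟩
    ∣ N G A ∣ + ∣ N G C ∣                   ∎
    where open ≤-Reasoning

  surplus-≤⇔ : (X Y : Subset n) → surplus G X ℤ.≤ surplus G Y ⇔ ∣ X ∣ + ∣ N G Y ∣ ≤ ∣ Y ∣ + ∣ N G X ∣
  surplus-≤⇔ X Y = m⊖n≤o⊖p⇔m+p≤o+n (∣ X ∣) (∣ N G X ∣) (∣ Y ∣) (∣ N G Y ∣)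

  surplus-supermodular : (A C : Subset n) →
    surplus G A ℤ.+ surplus G C ℤ.≤ surplus G (A ∪ C) ℤ.+ surplus G (A ∩ C)
  surplus-supermodular A C =
    subst₂ ℤ._≤_ (sym (surplus+surplus A C)) (sym (surplus+surplus (A ∪ C) (A ∩ C)))
    (Equivalence.from (m⊖n≤o⊖p⇔m+p≤o+n (∣ A ∣ + ∣ C ∣) (∣ N G A ∣ + ∣ N G C ∣)
                                         (∣ A ∪ C ∣ + ∣ A ∩ C ∣) (∣ N G (A ∪ C) ∣ + ∣ N G (A ∩ C) ∣)) (begin
      ∣ A ∣ + ∣ C ∣ + (∣ N G (A ∪ C) ∣ + ∣ N G (A ∩ C) ∣)   ≤⟨ +-monoʳ-≤ (∣ A ∣ + ∣ C ∣) (∣N∣-submodular A C) ⟩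
      ∣ A ∣ + ∣ C ∣ + (∣ N G A ∣ + ∣ N G C ∣)               ≡⟨ cong (_+ (∣ N G A ∣ + ∣ N G C ∣))
                                                                (sym (∣p∪q∣+∣p∩q∣≡∣p∣+∣q∣ A C)) ⟩
      ∣ A ∪ C ∣ + ∣ A ∩ C ∣ + (∣ N G A ∣ + ∣ N G C ∣)       ∎))
    where
    open ≤-Reasoning
    surplus+surplus : ∀ X Y → surplus G X ℤ.+ surplus G Y ≡ (∣ X ∣ + ∣ Y ∣) ℤ.⊖ (∣ N G X ∣ + ∣ N G Y ∣)
    surplus+surplus X Y = [m⊖n]+[o⊖p]≡[m+o]⊖[n+p] (∣ X ∣) (∣ N G X ∣) (∣ Y ∣) (∣ N G Y ∣)

  -- X ∩ N X, Z and N (X ─ N X) are disjoint parts of N X, so deleting X ∩ N X from X shrinks the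
  -- neighbourhood by at least ∣ X ∩ N X ∣ + ∣ Z ∣.
  surplus-─N-gain : (X : Subset n) {Z : Subset n} →
                    Z ⊆ N G X → Disjoint Z X → Disjoint Z (N G (X ─ N G X)) →
                    ℤ.+ ∣ Z ∣ ℤ.+ surplus G X ℤ.≤ surplus G (X ─ N G X)
  surplus-─N-gain X {Z} Z⊆NX Z#X Z#NI =
    subst (ℤ._≤ surplus G I) (sym (ℤ.distribʳ-⊖-+-pos (∣ Z ∣) (∣ X ∣) (∣ N G X ∣)))
      (Equivalence.from (m⊖n≤o⊖p⇔m+p≤o+n (∣ Z ∣ + ∣ X ∣) _ _ _) (begin
        ∣ Z ∣ + ∣ X ∣ + ∣ N G I ∣               ≡⟨ cong (λ k → ∣ Z ∣ + k + ∣ N G I ∣) ∣X∣≡∣W∣+∣I∣ ⟩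
        ∣ Z ∣ + (∣ W ∣ + ∣ I ∣) + ∣ N G I ∣     ≡⟨ regroup (∣ Z ∣) (∣ W ∣) (∣ I ∣) (∣ N G I ∣) ⟩
        ∣ I ∣ + (∣ N G I ∣ + ∣ W ∣ + ∣ Z ∣)     ≡⟨ cong (λ k → ∣ I ∣ + (k + ∣ Z ∣)) (sym ∣NI∪W∣≡∣NI∣+∣W∣) ⟩
        ∣ I ∣ + (∣ N G I ∪ W ∣ + ∣ Z ∣)         ≤⟨ +-monoʳ-≤ ∣ I ∣ ∣NI∪W∣+∣Z∣≤∣NX∣ ⟩
        ∣ I ∣ + ∣ N G X ∣                       ∎))
    where
    open ≤-Reasoning
    I W : Subset n
    I = X ─ N G X
    W = X ∩ N G X
    regroup : ∀ z w i ni → z + (w + i) + ni ≡ i + (ni + w + z)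
    regroup = solve-∀
    NI#W : Disjoint (N G I) W
    NI#W x∈NI x∈W with x∈N⁻ x∈NI
    ... | u , u∈I , u~x = x∈p─q⇒x∉q X (N G X) u∈I (x∈N⁺ (p∩q⊆p X (N G X) x∈W) (adj-sym u~x))
    NI∪W⊆NX : N G I ∪ W ⊆ N G X
    NI∪W⊆NX x∈ with x∈p∪q⁻ (N G I) W x∈
    ... | inj₁ x∈NI = N-mono (p─q⊆p X (N G X)) x∈NI
    ... | inj₂ x∈W  = p∩q⊆q X (N G X) x∈W
    NI∪W#Z : Disjoint (N G I ∪ W) Z
    NI∪W#Z x∈ x∈Z with x∈p∪q⁻ (N G I) W x∈
    ... | inj₁ x∈NI = Z#NI x∈Z x∈NI
    ... | inj₂ x∈W  = Z#X x∈Z (p∩q⊆p X (N G X) x∈W)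
    ∣X∣≡∣W∣+∣I∣ : ∣ X ∣ ≡ ∣ W ∣ + ∣ I ∣
    ∣X∣≡∣W∣+∣I∣ = ∣p∣≡∣p∩q∣+∣p─q∣ X (N G X)
    ∣NI∪W∣≡∣NI∣+∣W∣ : ∣ N G I ∪ W ∣ ≡ ∣ N G I ∣ + ∣ W ∣
    ∣NI∪W∣≡∣NI∣+∣W∣ = Disjoint⇒∣p∪q∣≡∣p∣+∣q∣ (N G I) W NI#W
    ∣NI∪W∣+∣Z∣≤∣NX∣ : ∣ N G I ∪ W ∣ + ∣ Z ∣ ≤ ∣ N G X ∣
    ∣NI∪W∣+∣Z∣≤∣NX∣ = Disjoint⇒∣p∣+∣q∣≤∣r∣ NI∪W#Z NI∪W⊆NX Z⊆NX

  surplus≤surplus[X─NX] : (X : Subset n) → surplus G X ℤ.≤ surplus G (X ─ N G X)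
  surplus≤surplus[X─NX] X = subst (ℤ._≤ surplus G (X ─ N G X)) (ℤ.+-identityˡ (surplus G X))
    (subst (λ k → ℤ.+ k ℤ.+ surplus G X ℤ.≤ surplus G (X ─ N G X)) (∣⊥∣≡0 n)
      (surplus-─N-gain X ⊥⊆ ⊥# ⊥#))
    where
    ⊥# : ∀ {p} → Disjoint ⊥ p
    ⊥# x∈⊥ = contradiction x∈⊥ ∉⊥

  ≤-surplus⇒critical : Critical G J → Independent G K → surplus G J ℤ.≤ surplus G K → Critical G K
  ≤-surplus⇒critical (_ , J-best) indK J≤K = indK , λ T indT → ℤ.≤-trans (J-best T indT) J≤K

  surplus-≤-∪ : Critical G J → surplus G J ℤ.≤ surplus G X → surplus G J ℤ.≤ surplus G Y →
                Independent G (X ∩ Y) → surplus G J ℤ.≤ surplus G (X ∪ Y)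
  surplus-≤-∪ {J} {X} {Y} (_ , J-best) J≤X J≤Y indX∩Y = ℤ-+-cancelʳ-≤ (surplus G J) (begin
    surplus G J ℤ.+ surplus G J               ≤⟨ ℤ.+-mono-≤ J≤X J≤Y ⟩
    surplus G X ℤ.+ surplus G Y               ≤⟨ surplus-supermodular X Y ⟩
    surplus G (X ∪ Y) ℤ.+ surplus G (X ∩ Y)   ≤⟨ ℤ.+-monoʳ-≤ (surplus G (X ∪ Y)) J-best-X∩Y ⟩
    surplus G (X ∪ Y) ℤ.+ surplus G J         ∎)
    where
    open ℤ.≤-Reasoning
    J-best-X∩Y : surplus G (X ∩ Y) ℤ.≤ surplus G J
    J-best-X∩Y = J-best (X ∩ Y) indX∩Y

  surplus-≤-J∪K : Critical G J → Critical G K → surplus G J ℤ.≤ surplus G (J ∪ K)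
  surplus-≤-J∪K {J} {K} critJ@(indJ , _) (_ , K-best) =
    surplus-≤-∪ critJ ℤ.≤-refl (K-best J indJ) (independent-⊆ (p∩q⊆p J K) indJ)

  -- J ∪ ((J ∪ K) ─ N (J ∪ K)) is again critical, so maximality of J puts (J ∪ K) ─ N (J ∪ K) inside J.
  critical⊆L : MaxCritical G J → Critical G K → K ⊆ L G J
  critical⊆L {J} {K} (critJ@(indJ , _) , J-largest) critK@(indK , _) {k} k∈K with k ∈? N G J
  ... | yes k∈NJ = q⊆p∪q J (N G J) k∈NJ
  ... | no  k∉NJ = p⊆p∪q (N G J) (I⊆J k∈I)
    where
    U I : Subset n
    U = J ∪ K
    I = U ─ N G U
    critI : Critical G I
    critI = ≤-surplus⇒critical critJ (independent-─N U)
              (ℤ.≤-trans (surplus-≤-J∪K critJ critK) (surplus≤surplus[X─NX] U))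
    critJ∪I : Critical G (J ∪ I)
    critJ∪I = ≤-surplus⇒critical critJ
      (independent-∪ indJ (proj₁ critI) λ x∈I x∈NJ →
        x∈p─q⇒x∉q U (N G U) x∈I (N-mono (p⊆p∪q {p = J} K) x∈NJ))
      (surplus-≤-J∪K critJ critI)
    I⊆J : I ⊆ J
    I⊆J x∈I = p⊆q∧∣q∣≤∣p∣⇒q⊆p (p⊆p∪q I) (J-largest (J ∪ I) critJ∪I) (q⊆p∪q J I x∈I)
    k∈I : k ∈ I
    k∈I = x∈p∧x∉q⇒x∈p─q (q⊆p∪q J K k∈K) λ k∈NU →
      [ k∉NJ , independent⇒∉N indK k∈K ]′ (x∈p∪q⁻ (N G J) (N G K) (N-∪ J K k∈NU))

  -- Deleting N B from J loses ∣ J ∩ N B ∣ vertices and at least ∣ B ∣ neighbours.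
  critical⇒HallCondition : Critical G J → HallCondition (N G J) J
  critical⇒HallCondition {J} (indJ , J-best) B B⊆NJ =
    +-cancelˡ-≤ (∣ J′ ∣ + ∣ N G J′ ∣) (∣ B ∣) (∣ J ∩ N G B ∣) (begin
      ∣ J′ ∣ + ∣ N G J′ ∣ + ∣ B ∣          ≡⟨ +-assoc (∣ J′ ∣) (∣ N G J′ ∣) (∣ B ∣) ⟩
      ∣ J′ ∣ + (∣ N G J′ ∣ + ∣ B ∣)        ≤⟨ +-monoʳ-≤ (∣ J′ ∣) (Disjoint⇒∣p∣+∣q∣≤∣r∣ NJ′#B NJ′⊆NJ B⊆NJ) ⟩
      ∣ J′ ∣ + ∣ N G J ∣                   ≤⟨ Equivalence.to (surplus-≤⇔ J′ J) (J-best J′ indJ′) ⟩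
      ∣ J ∣ + ∣ N G J′ ∣                   ≡⟨ cong (_+ ∣ N G J′ ∣) (∣p∣≡∣p∩q∣+∣p─q∣ J (N G B)) ⟩
      ∣ J ∩ N G B ∣ + ∣ J′ ∣ + ∣ N G J′ ∣  ≡⟨ regroup (∣ J ∩ N G B ∣) (∣ J′ ∣) (∣ N G J′ ∣) ⟩
      ∣ J′ ∣ + ∣ N G J′ ∣ + ∣ J ∩ N G B ∣  ∎)
    where
    open ≤-Reasoning
    J′ : Subset n
    J′ = J ─ N G B
    indJ′ : Independent G J′
    indJ′ = independent-⊆ (p─q⊆p J (N G B)) indJ
    NJ′⊆NJ : N G J′ ⊆ N G J
    NJ′⊆NJ = N-mono (p─q⊆p J (N G B))
    regroup : ∀ a b c → a + b + c ≡ b + c + a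
    regroup = solve-∀
    NJ′#B : Disjoint (N G J′) B
    NJ′#B x∈NJ′ x∈B with x∈N⁻ x∈NJ′
    ... | u , u∈J′ , u~x = x∈p─q⇒x∉q J (N G B) u∈J′ (x∈N⁺ x∈B (adj-sym u~x))

  ∣S∩L∣≤∣J∣ : Critical G J → Independent G S → ∣ S ∩ L G J ∣ ≤ ∣ J ∣
  ∣S∩L∣≤∣J∣ {J} {S} critJ indS = begin
    ∣ S ∩ L G J ∣                ≡⟨ cong ∣_∣ (∩-distribˡ-∪ S J (N G J)) ⟩
    ∣ (S ∩ J) ∪ B ∣              ≤⟨ ∣p∪q∣≤∣p∣+∣q∣ (S ∩ J) B ⟩
    ∣ S ∩ J ∣ + ∣ B ∣            ≤⟨ +-mono-≤ (≤-reflexive (cong ∣_∣ (∩-comm S J)))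
                                            (critical⇒HallCondition critJ B (p∩q⊆q S (N G J))) ⟩
    ∣ J ∩ S ∣ + ∣ J ∩ N G B ∣    ≤⟨ +-monoʳ-≤ (∣ J ∩ S ∣) (p⊆q⇒∣p∣≤∣q∣ J∩NB⊆J─S) ⟩
    ∣ J ∩ S ∣ + ∣ J ─ S ∣        ≡⟨ sym (∣p∣≡∣p∩q∣+∣p─q∣ J S) ⟩
    ∣ J ∣                        ∎
    where
    open ≤-Reasoning
    B : Subset n
    B = S ∩ N G J
    J∩NB⊆J─S : J ∩ N G B ⊆ J ─ S
    J∩NB⊆J─S x∈ = let x∈J , x∈NB = x∈p∩q⁻ J (N G B) x∈ in
      x∈p∧x∉q⇒x∈p─q x∈J λ x∈S → independent⇒∉N indS x∈S (N-mono (p∩q⊆p S (N G J)) x∈NB)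

  -- A neighbour of K outside L would add to the gain of deleting N (J ∪ K) from J ∪ K, and the
  -- resulting independent set would have larger surplus than J.
  N-critical⊆L : MaxCritical G J → Critical G K → N G K ⊆ L G J
  N-critical⊆L {J} {K} maxJ@(critJ , _) critK {w} w∈NK with w ∈? L G J
  ... | yes w∈L = w∈L
  ... | no  w∉L = contradiction (ℤ.<-≤-trans U<I (ℤ.≤-trans I≤J J≤U)) (ℤ.<-irrefl refl)
    where
    U I : Subset n
    U = J ∪ K
    I = U ─ N G U
    U⊆L : U ⊆ L G J
    U⊆L x∈U with x∈p∪q⁻ J K x∈U
    ... | inj₁ x∈J = p⊆p∪q (N G J) x∈J
    ... | inj₂ x∈K = critical⊆L maxJ critK x∈K
    NI⊆L : N G I ⊆ L G J
    NI⊆L x∈NI with x∈N⁻ x∈NI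
    ... | u , u∈I , u~x with x∈p∪q⁻ J (N G J) (U⊆L (p─q⊆p U (N G U) u∈I))
    ...   | inj₁ u∈J  = q⊆p∪q J (N G J) (x∈N⁺ u∈J u~x)
    ...   | inj₂ u∈NJ = contradiction (N-mono (p⊆p∪q {p = J} K) u∈NJ) (x∈p─q⇒x∉q U (N G U) u∈I)
    gain : ℤ.+ ∣ ⁅ w ⁆ ∣ ℤ.+ surplus G U ℤ.≤ surplus G I
    gain = surplus-─N-gain U (x∈p⇒⁅x⁆⊆p (N-mono (q⊆p∪q J K) w∈NK))
             (x∉p⇒Disjoint⁅x⁆p (w∉L ∘ U⊆L)) (x∉p⇒Disjoint⁅x⁆p (w∉L ∘ NI⊆L))
    U<I : surplus G U ℤ.< surplus G I
    U<I = ℤ.suc[i]≤j⇒i<j (subst (λ k → ℤ.+ k ℤ.+ surplus G U ℤ.≤ surplus G I) (∣⁅x⁆∣≡1 w) gain)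
    I≤J : surplus G I ℤ.≤ surplus G J
    I≤J = proj₂ critJ I (independent-─N U)
    J≤U : surplus G J ℤ.≤ surplus G U
    J≤U = surplus-≤-J∪K critJ critK

  -- Maximum independent sets and L

  J∪T-independent : Critical G J → T ⊆ Lᶜ G J → Independent G T → Independent G (J ∪ T)
  J∪T-independent {J} (indJ , _) T⊆Lᶜ indT =
    independent-∪ indJ indT λ x∈T x∈NJ → x∈∁p⇒x∉p (T⊆Lᶜ x∈T) (q⊆p∪q J (N G J) x∈NJ)

  ∣J∪T∣≡∣J∣+∣T∣ : T ⊆ Lᶜ G J → ∣ J ∪ T ∣ ≡ ∣ J ∣ + ∣ T ∣
  ∣J∪T∣≡∣J∣+∣T∣ {T} {J} T⊆Lᶜ =
    Disjoint⇒∣p∪q∣≡∣p∣+∣q∣ J T λ x∈J x∈T → x∈∁p⇒x∉p (T⊆Lᶜ x∈T) (p⊆p∪q (N G J) x∈J)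

  ∣S∣≤∣J∣+∣S∩Lᶜ∣ : Critical G J → Independent G S → ∣ S ∣ ≤ ∣ J ∣ + ∣ S ∩ Lᶜ G J ∣
  ∣S∣≤∣J∣+∣S∩Lᶜ∣ {J} {S} critJ indS =
    subst (_≤ ∣ J ∣ + ∣ S ∩ Lᶜ G J ∣) (sym (∣p∣≡∣p∩q∣+∣p∩∁q∣ S (L G J)))
    (+-monoˡ-≤ (∣ S ∩ Lᶜ G J ∣) (∣S∩L∣≤∣J∣ critJ indS))

  maxIndep⇒maxIndepIn-Lᶜ : Critical G J → MaxIndep G S → MaxIndepIn G (Lᶜ G J) (S ∩ Lᶜ G J)
  maxIndep⇒maxIndepIn-Lᶜ {J} {S} critJ (_ , indS , S-largest) =
    p∩q⊆q S (Lᶜ G J) , independent-⊆ (p∩q⊆p S (Lᶜ G J)) indS , λ T T⊆Lᶜ indT →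
      +-cancelˡ-≤ (∣ J ∣) (∣ T ∣) (∣ S ∩ Lᶜ G J ∣) (begin
        ∣ J ∣ + ∣ T ∣              ≡⟨ sym (∣J∪T∣≡∣J∣+∣T∣ T⊆Lᶜ) ⟩
        ∣ J ∪ T ∣                  ≤⟨ S-largest (J ∪ T) ⊆⊤ (J∪T-independent critJ T⊆Lᶜ indT) ⟩
        ∣ S ∣                      ≤⟨ ∣S∣≤∣J∣+∣S∩Lᶜ∣ critJ indS ⟩
        ∣ J ∣ + ∣ S ∩ Lᶜ G J ∣     ∎)
    where open ≤-Reasoning

  maxIndepIn-Lᶜ⇒maxIndep : Critical G J → MaxIndepIn G (Lᶜ G J) T → MaxIndep G (J ∪ T)
  maxIndepIn-Lᶜ⇒maxIndep {J} {T} critJ (T⊆Lᶜ , indT , T-largest) =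
    ⊆⊤ , J∪T-independent critJ T⊆Lᶜ indT , λ R _ indR → begin
      ∣ R ∣                    ≤⟨ ∣S∣≤∣J∣+∣S∩Lᶜ∣ critJ indR ⟩
      ∣ J ∣ + ∣ R ∩ Lᶜ G J ∣   ≤⟨ +-monoʳ-≤ (∣ J ∣) (T-largest (R ∩ Lᶜ G J) (p∩q⊆q R (Lᶜ G J))
                                                     (independent-⊆ (p∩q⊆p R (Lᶜ G J)) indR)) ⟩
      ∣ J ∣ + ∣ T ∣            ≡⟨ sym (∣J∪T∣≡∣J∣+∣T∣ T⊆Lᶜ) ⟩
      ∣ J ∪ T ∣                ∎
    where open ≤-Reasoning

  ∣J∣≤∣S∩L∣ : Critical G J → MaxIndep G S → ∣ J ∣ ≤ ∣ S ∩ L G J ∣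
  ∣J∣≤∣S∩L∣ {J} {S} critJ (_ , indS , S-largest) =
    +-cancelʳ-≤ (∣ S ∩ Lᶜ G J ∣) (∣ J ∣) (∣ S ∩ L G J ∣) (begin
      ∣ J ∣ + ∣ S ∩ Lᶜ G J ∣               ≡⟨ sym (∣J∪T∣≡∣J∣+∣T∣ (p∩q⊆q S (Lᶜ G J))) ⟩
      ∣ J ∪ (S ∩ Lᶜ G J) ∣                 ≤⟨ S-largest (J ∪ (S ∩ Lᶜ G J)) ⊆⊤
                                               (J∪T-independent critJ (p∩q⊆q S (Lᶜ G J))
                                                 (independent-⊆ (p∩q⊆p S (Lᶜ G J)) indS)) ⟩
      ∣ S ∣                                ≡⟨ ∣p∣≡∣p∩q∣+∣p∩∁q∣ S (L G J) ⟩
      ∣ S ∩ L G J ∣ + ∣ S ∩ Lᶜ G J ∣       ∎)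
    where open ≤-Reasoning

  -- Core and nucleus

  core∩L⊆J : Critical G J → InCore G v → v ∈ L G J → v ∈ J
  core∩L⊆J {J} critJ (_ , v∈Ω) v∈L with ∃-maxIndepIn (Lᶜ G J)
  ... | T , maxT@(T⊆Lᶜ , _) with x∈p∪q⁻ J T (v∈Ω (J ∪ T) (maxIndepIn-Lᶜ⇒maxIndep critJ maxT))
  ...   | inj₁ v∈J = v∈J
  ...   | inj₂ v∈T = contradiction v∈L (x∈∁p⇒x∉p (T⊆Lᶜ v∈T))

  core∩Lᶜ⊆coreLᶜ : Critical G J → InCore G v → v ∈ Lᶜ G J → InCoreIn G (Lᶜ G J) v
  core∩Lᶜ⊆coreLᶜ {J} critJ (_ , v∈Ω) v∈Lᶜ = v∈Lᶜ , λ T maxT →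
    [ (λ v∈J → contradiction (p⊆p∪q (N G J) v∈J) (x∈∁p⇒x∉p v∈Lᶜ)) , id ]′
      (x∈p∪q⁻ J T (v∈Ω (J ∪ T) (maxIndepIn-Lᶜ⇒maxIndep critJ maxT)))

  coreLᶜ⊆core : Critical G J → InCoreIn G (Lᶜ G J) v → InCore G v
  coreLᶜ⊆core {J} critJ (_ , v∈Ω) =
    ∈⊤ , λ S maxS → p∩q⊆p S (Lᶜ G J) (v∈Ω (S ∩ Lᶜ G J) (maxIndep⇒maxIndepIn-Lᶜ critJ maxS))

  S∩L-maxCritical : MaxCritical G J → MaxIndep G S → N G (S ∩ L G J) ⊆ L G J → MaxCritical G (S ∩ L G J)
  S∩L-maxCritical {J} {S} (critJ , J-largest) maxS@(_ , indS , _) NA⊆L =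
    ≤-surplus⇒critical critJ indA (Equivalence.from (surplus-≤⇔ J A) J≤A) ,
    λ K critK → ≤-trans (J-largest K critK) ∣J∣≤∣A∣
    where
    open ≤-Reasoning
    A : Subset n
    A = S ∩ L G J
    indA : Independent G A
    indA = independent-⊆ (p∩q⊆p S (L G J)) indS
    ∣J∣≤∣A∣ : ∣ J ∣ ≤ ∣ A ∣
    ∣J∣≤∣A∣ = ∣J∣≤∣S∩L∣ critJ maxS
    ∣NA∣+∣A∣≤∣J∣+∣NJ∣ : ∣ N G A ∣ + ∣ A ∣ ≤ ∣ J ∣ + ∣ N G J ∣
    ∣NA∣+∣A∣≤∣J∣+∣NJ∣ = ≤-trans
      (Disjoint⇒∣p∣+∣q∣≤∣r∣ (λ x∈NA x∈A → independent⇒∉N indA x∈A x∈NA) NA⊆L (p∩q⊆q S (L G J)))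
      (∣p∪q∣≤∣p∣+∣q∣ J (N G J))
    J≤A : ∣ J ∣ + ∣ N G A ∣ ≤ ∣ A ∣ + ∣ N G J ∣
    J≤A = +-cancelʳ-≤ (∣ A ∣) (∣ J ∣ + ∣ N G A ∣) (∣ A ∣ + ∣ N G J ∣) (begin
      ∣ J ∣ + ∣ N G A ∣ + ∣ A ∣       ≡⟨ +-assoc (∣ J ∣) (∣ N G A ∣) (∣ A ∣) ⟩
      ∣ J ∣ + (∣ N G A ∣ + ∣ A ∣)     ≤⟨ +-monoʳ-≤ (∣ J ∣) ∣NA∣+∣A∣≤∣J∣+∣NJ∣ ⟩
      ∣ J ∣ + (∣ J ∣ + ∣ N G J ∣)     ≤⟨ +-mono-≤ ∣J∣≤∣A∣ (+-monoˡ-≤ (∣ N G J ∣) ∣J∣≤∣A∣) ⟩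
      ∣ A ∣ + (∣ A ∣ + ∣ N G J ∣)     ≡⟨ +-comm (∣ A ∣) (∣ A ∣ + ∣ N G J ∣) ⟩
      ∣ A ∣ + ∣ N G J ∣ + ∣ A ∣       ∎)

  -- Otherwise ⁅ v ⁆ ∪ (J′ ∩ N J) would be matched injectively into J ─ J′, making J′ smaller than J.
  partner∈nucleus : MaxCritical G J → (M : Matching (N G J) J) → v ∈ N G J → w ∉ L G J →
                    adj G v w ≡ true → InNucleus G (Matching.partner M v)
  partner∈nucleus {J} {v} {w} maxJ@(critJ , _) M v∈NJ w∉L v~w J′ (critJ′@(indJ′ , _) , J′-largest)
    with Matching.partner M v ∈? J′
  ... | yes v′∈J′ = v′∈J′
  ... | no  v′∉J′ = contradiction (J′-largest J critJ) (<⇒≱ ∣J′∣<∣J∣)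
    where
    open Matching M
    open ≤-Reasoning
    P Z : Subset n
    P = J′ ∩ N G J
    Z = ⁅ v ⁆ ∪ P
    v∉P : v ∉ P
    v∉P v∈P = w∉L (N-critical⊆L maxJ critJ′ (x∈N⁺ (p∩q⊆p J′ (N G J) v∈P) v~w))
    Z⊆NJ : Z ⊆ N G J
    Z⊆NJ = ∪-lub (x∈p⇒⁅x⁆⊆p v∈NJ) (p∩q⊆q J′ (N G J))
    partner-Z : ∀ {z} → z ∈ Z → partner z ∈ J ─ J′
    partner-Z {z} z∈Z with x∈p∪q⁻ ⁅ v ⁆ P z∈Z
    ... | inj₁ z∈⁅v⁆ rewrite x∈⁅y⁆⇒x≡y v z∈⁅v⁆ = x∈p∧x∉q⇒x∈p─q (partner∈ v∈NJ) v′∉J′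
    ... | inj₂ z∈P   = x∈p∧x∉q⇒x∈p─q (partner∈ (Z⊆NJ z∈Z))
      λ z′∈J′ → independent⇒∉N indJ′ z′∈J′ (x∈N⁺ (p∩q⊆p J′ (N G J) z∈P) (adjacent (Z⊆NJ z∈Z)))
    ∣P∣<∣J─J′∣ : ∣ P ∣ < ∣ J ─ J′ ∣
    ∣P∣<∣J─J′∣ = begin-strict
      ∣ P ∣               <⟨ n<1+n (∣ P ∣) ⟩
      suc ∣ P ∣           ≡⟨ cong (_+ ∣ P ∣) (sym (∣⁅x⁆∣≡1 v)) ⟩
      ∣ ⁅ v ⁆ ∣ + ∣ P ∣   ≡⟨ sym (Disjoint⇒∣p∪q∣≡∣p∣+∣q∣ ⁅ v ⁆ P (x∉p⇒Disjoint⁅x⁆p v∉P)) ⟩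
      ∣ Z ∣               ≤⟨ injection⇒∣p∣≤∣q∣ partner partner-Z (λ y∈ z∈ → injective (Z⊆NJ y∈) (Z⊆NJ z∈)) ⟩
      ∣ J ─ J′ ∣          ∎
    ∣J′∣<∣J∣ : ∣ J′ ∣ < ∣ J ∣
    ∣J′∣<∣J∣ = begin-strict
      ∣ J′ ∣                    ≤⟨ p⊆q⇒∣p∣≤∣q∣ (λ x∈J′ → x∈p∩q⁺ (x∈J′ , critical⊆L maxJ critJ′ x∈J′)) ⟩
      ∣ J′ ∩ L G J ∣            ≡⟨ cong ∣_∣ (∩-distribˡ-∪ J′ J (N G J)) ⟩
      ∣ (J′ ∩ J) ∪ P ∣          ≤⟨ ∣p∪q∣≤∣p∣+∣q∣ (J′ ∩ J) P ⟩
      ∣ J′ ∩ J ∣ + ∣ P ∣        ≡⟨ cong (λ s → ∣ s ∣ + ∣ P ∣) (∩-comm J′ J) ⟩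
      ∣ J ∩ J′ ∣ + ∣ P ∣        <⟨ +-monoʳ-< (∣ J ∩ J′ ∣) ∣P∣<∣J─J′∣ ⟩
      ∣ J ∩ J′ ∣ + ∣ J ─ J′ ∣   ≡⟨ sym (∣p∣≡∣p∩q∣+∣p─q∣ J J′) ⟩
      ∣ J ∣                     ∎

  CoreIsNucleus : Set
  CoreIsNucleus = ∀ v → InCore G v ⇔ InNucleus G v

  core≡nucleus⇒coreLᶜ≡∅ : MaxCritical G J → CoreIsNucleus → ∀ v → ¬ InCoreIn G (Lᶜ G J) v
  core≡nucleus⇒coreLᶜ≡∅ {J} maxJ@(critJ , _) core≡nucleus v v∈coreLᶜ@(v∈Lᶜ , _) =
    x∈∁p⇒x∉p v∈Lᶜ (p⊆p∪q (N G J) v∈J)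
    where
    v∈J : v ∈ J
    v∈J = Equivalence.to (core≡nucleus v) (coreLᶜ⊆core critJ v∈coreLᶜ) J maxJ

  -- A vertex of N J on the boundary is adjacent to its partner under a matching of N J into J,
  -- and that partner lies in the nucleus, hence in every maximum independent set.
  core≡nucleus⇒corona∩∂L≡∅ : MaxCritical G J → CoreIsNucleus → ∀ v → ¬ (InCorona G v × InBoundary G J v)
  core≡nucleus⇒corona∩∂L≡∅ {J} maxJ@(critJ , _) core≡nucleus v
    ((S , maxS@(_ , indS , _) , v∈S) , v∈L , w , w∈Lᶜ , v~w)
    with x∈p∪q⁻ J (N G J) v∈L
  ... | inj₁ v∈J  = x∈∁p⇒x∉p w∈Lᶜ (q⊆p∪q J (N G J) (x∈N⁺ v∈J v~w))
  ... | inj₂ v∈NJ = independent⇒∉N indS v′∈S (x∈N⁺ v∈S (adjacent v∈NJ))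
    where
    M : Matching (N G J) J
    M = hall (critical⇒HallCondition critJ)
    open Matching M
    v′∈S : partner v ∈ S
    v′∈S = proj₂ (Equivalence.from (core≡nucleus (partner v))
                    (partner∈nucleus maxJ M v∈NJ (x∈∁p⇒x∉p w∈Lᶜ) v~w)) S maxS

  coreLᶜ≡∅⇒core⊆nucleus : Critical G J → (∀ v → ¬ InCoreIn G (Lᶜ G J) v) → InCore G v → InNucleus G v
  coreLᶜ≡∅⇒core⊆nucleus {J} {v} critJ coreLᶜ≡∅ v∈core J′ maxJ′@(critJ′ , _) =
    core∩L⊆J critJ′ v∈core (critical⊆L maxJ′ critJ v∈J)
    where
    v∈J : v ∈ J
    v∈J = core∩L⊆J critJ v∈core (x∉∁p⇒x∈p λ v∈Lᶜ → coreLᶜ≡∅ v (core∩Lᶜ⊆coreLᶜ critJ v∈core v∈Lᶜ))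

  corona∩∂L≡∅⇒nucleus⊆core : MaxCritical G J → (∀ v → ¬ (InCorona G v × InBoundary G J v)) →
                             InNucleus G v → InCore G v
  corona∩∂L≡∅⇒nucleus⊆core {J} maxJ corona∩∂L≡∅ v∈nucleus =
    ∈⊤ , λ S maxS → p∩q⊆p S (L G J) (v∈nucleus (S ∩ L G J) (S∩L-maxCritical maxJ maxS (N[S∩L]⊆L maxS)))
    where
    N[S∩L]⊆L : MaxIndep G S → N G (S ∩ L G J) ⊆ L G J
    N[S∩L]⊆L {S} maxS {y} y∈N with x∈N⁻ y∈N
    ... | u , u∈S∩L , u~y = x∉∁p⇒x∈p λ y∈Lᶜ → corona∩∂L≡∅ u
      ((S , maxS , p∩q⊆p S (L G J) u∈S∩L) , p∩q⊆q S (L G J) u∈S∩L , y , y∈Lᶜ , u~y)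

mainTheorem8 : ∀ {n : ℕ} (G : Graph n) (J : Subset n) → MaxCritical G J →
    ((∀ (v : Fin n) → InCore G v ⇔ InNucleus G v)
      ⇔ ((∀ (v : Fin n) → ¬ InCoreIn G (Lᶜ G J) v)
         × (∀ (v : Fin n) → ¬ (InCorona G v × InBoundary G J v))))
mainTheorem8 G J maxJ = mk⇔
  (λ core≡nucleus →
    core≡nucleus⇒coreLᶜ≡∅ G maxJ core≡nucleus , core≡nucleus⇒corona∩∂L≡∅ G maxJ core≡nucleus)
  (λ (coreLᶜ≡∅ , corona∩∂L≡∅) v →
    mk⇔ (coreLᶜ≡∅⇒core⊆nucleus G (proj₁ maxJ) coreLᶜ≡∅) (corona∩∂L≡∅⇒nucleus⊆core G maxJ corona∩∂L≡∅))
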